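{- Let $n$ be an odd positive integer, let $h$ be a positive integer and $m=2^h-1$ with $n<m$. If $\nu$ is an integer with $\nu\ge 2h+1$, then $$B(n2^\nu-m)=B(n)+\nu-h$$ and $$B\big((n2^\nu-m)^2\big)=B(n^2)+\nu-1,$$ where $B(x)$ denotes the number of ones in the binary expansion of $x$.
   Context: For a positive integer $x$, $B(x)$ denotes the sum of the binary digits of $x$ (its Hamming weight). -}

module Defs where

open import Data.Nat using (ℕ; zero; suc; _+_; _%_; _/_)

-- Sum of binary digits with fuel: each step strips the lowest bit (x % 2)
-- and continues with x / 2.  Fuel x suffices since x / 2 < x for x > 0,
-- and x halvings bring x to 0.
B-fuel : ℕ → ℕ → ℕ
B-fuel zero    x = 0
B-fuel (suc f) x = x % 2 + B-fuel f (x / 2)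

B : ℕ → ℕ
B x = B-fuel x x

{-# OPTIONS --safe #-}

-- Subtracting 0 < b ≤ 2^k from a·2^k borrows one from a:
--   a·2^k − b = (a − 1)·2^k + (2^k − b),
-- and the low block 2^k − b is the k-bit complement of b − 1, so
--   B(a·2^k − b) = B(a − 1) + k − B(b − 1).
-- For m = 2^h − 1 and odd n, where B(n − 1) = B(n) − 1, this gives the
-- first formula at once.  For the second,
--   (n·2^ν − m)² = (n²·2^(ν−1) − nm)·2^(ν+1) + m²   with m² < 2^(ν+1),
-- and the borrow identity applies again to n²·2^(ν−1) − nm; the other
-- terms are B(m²) = h (as m² = m·2^h − m) and B(nm − 1) = h − 1
-- (as nm − 1 = n·2^h − (n + 1)), both borrow identities as well.
module Submission where

open import Defs
open import Data.Nat using (ℕ; zero; suc; _+_; _*_; _∸_; _^_; _≤_; _<_; _%_; _/_; z≤n; s≤s; z<s; NonZero; >-nonZero)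
open import Data.Nat.Properties
open import Data.Nat.DivMod
open import Algebra.Properties.CommutativeSemigroup +-commutativeSemigroup using (x∙yz≈y∙xz)
open import Data.Nat.Divisibility using (n∣m*n)
open import Data.Nat.Tactic.RingSolver using (solve)
open import Data.Fin as Fin using ()
open import Data.List using (_∷_; [])
open import Data.Product using (_×_; _,_)
open import Relation.Binary.PropositionalEquality
open ≡-Reasoning

B-fuel-zero : ∀ f → B-fuel f 0 ≡ 0
B-fuel-zero zero    = refl
B-fuel-zero (suc f) = B-fuel-zero f

m≤1+n⇒m/2≤n : ∀ {m n} → m ≤ suc n → m / 2 ≤ n
m≤1+n⇒m/2≤n {zero}  _      = z≤n
m≤1+n⇒m/2≤n {suc m} m<1+n = ≤-pred (<-≤-trans (m/n<m (suc m) 2 ≤-refl) m<1+n)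

B-fuel-irrelevant : ∀ {f g x} → x ≤ f → x ≤ g → B-fuel f x ≡ B-fuel g x
B-fuel-irrelevant {zero}  {g}     z≤n _   = sym (B-fuel-zero g)
B-fuel-irrelevant {suc f} {zero}  _   z≤n = B-fuel-zero (suc f)
B-fuel-irrelevant {suc f} {suc g} {x} x≤1+f x≤1+g =
  cong (x % 2 +_) (B-fuel-irrelevant (m≤1+n⇒m/2≤n x≤1+f) (m≤1+n⇒m/2≤n x≤1+g))

B[x]≡x%2+B[x/2] : ∀ x → B x ≡ x % 2 + B (x / 2)
B[x]≡x%2+B[x/2] zero    = refl
B[x]≡x%2+B[x/2] (suc x) =
  cong (suc x % 2 +_) (B-fuel-irrelevant {x} {suc x / 2} (m≤1+n⇒m/2≤n ≤-refl) ≤-refl)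

B[r+q*2]≡r+B[q] : ∀ r q → r < 2 → B (r + q * 2) ≡ r + B q
B[r+q*2]≡r+B[q] r q r<2 = begin
  B (r + q * 2)                          ≡⟨ B[x]≡x%2+B[x/2] (r + q * 2) ⟩
  (r + q * 2) % 2 + B ((r + q * 2) / 2)  ≡⟨ cong₂ _+_ [r+q*2]%2≡r (cong B [r+q*2]/2≡q) ⟩
  r + B q                                ∎
  where
  [r+q*2]%2≡r : (r + q * 2) % 2 ≡ r
  [r+q*2]%2≡r = trans ([m+kn]%n≡m%n r q 2) (m<n⇒m%n≡m r<2)
  [r+q*2]/2≡q : (r + q * 2) / 2 ≡ q
  [r+q*2]/2≡q = trans (+-distrib-/-∣ʳ r (n∣m*n q)) (cong₂ _+_ (m<n⇒m/n≡0 r<2) (m*n/n≡m q 2))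

odd⇒B[n]≡1+B[n∸1] : ∀ {n} → n % 2 ≡ 1 → B n ≡ suc (B (n ∸ 1))
odd⇒B[n]≡1+B[n∸1] {n} n%2≡1 = begin
  B n               ≡⟨ cong B n≡1+q*2 ⟩
  B (1 + q * 2)     ≡⟨ B[r+q*2]≡r+B[q] 1 q ≤-refl ⟩
  suc (B q)         ≡⟨ cong suc (B[r+q*2]≡r+B[q] 0 q z<s) ⟨
  suc (B (q * 2))   ≡⟨ cong (λ k → suc (B (k ∸ 1))) n≡1+q*2 ⟨
  suc (B (n ∸ 1))   ∎
  where
  q = n / 2
  n≡1+q*2 : n ≡ 1 + q * 2
  n≡1+q*2 = trans (m≡m%n+[m/n]*n n 2) (cong (_+ q * 2) n%2≡1)

B[a*2^k+c]≡B[a]+B[c] : ∀ k a c → c < 2 ^ k → B (a * 2 ^ k + c) ≡ B a + B c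
B[a*2^k+c]≡B[a]+B[c] zero    a (suc c) (s≤s ())
B[a*2^k+c]≡B[a]+B[c] zero    a zero    _ =
  trans (cong B (trans (+-identityʳ (a * 1)) (*-identityʳ a))) (sym (+-identityʳ (B a)))
B[a*2^k+c]≡B[a]+B[c] (suc k) a c c<2^[1+k] = begin
  B (a * 2 ^ suc k + c)       ≡⟨ cong B (shift-digit a (2 ^ k) r q c≡r+q*2) ⟩
  B (r + (a * 2 ^ k + q) * 2) ≡⟨ B[r+q*2]≡r+B[q] r (a * 2 ^ k + q) r<2 ⟩
  r + B (a * 2 ^ k + q)       ≡⟨ cong (r +_) (B[a*2^k+c]≡B[a]+B[c] k a q q<2^k) ⟩
  r + (B a + B q)             ≡⟨ x∙yz≈y∙xz r (B a) (B q) ⟩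
  B a + (r + B q)             ≡⟨ cong (B a +_) (B[r+q*2]≡r+B[q] r q r<2) ⟨
  B a + B (r + q * 2)         ≡⟨ cong (λ x → B a + B x) c≡r+q*2 ⟨
  B a + B c                   ∎
  where
  r = c % 2
  q = c / 2
  r<2 : r < 2
  r<2 = m%n<n c 2
  c≡r+q*2 : c ≡ r + q * 2
  c≡r+q*2 = m≡m%n+[m/n]*n c 2
  q<2^k : q < 2 ^ k
  q<2^k = m<n*o⇒m/o<n (subst (c <_) (*-comm 2 (2 ^ k)) c<2^[1+k])
  shift-digit : ∀ a P r q {c} → c ≡ r + q * 2 → a * (2 * P) + c ≡ r + (a * P + q) * 2
  shift-digit a P r q refl = solve (a ∷ P ∷ r ∷ q ∷ [])

[m∸n]*2≡2*m∸n*2 : ∀ m n → (m ∸ n) * 2 ≡ 2 * m ∸ n * 2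
[m∸n]*2≡2*m∸n*2 m n = trans (*-distribʳ-∸ 2 m n) (cong (_∸ n * 2) (*-comm m 2))

m*2<2*n⇒m<n : ∀ {m n} → m * 2 < 2 * n → m < n
m*2<2*n⇒m<n {m} {n} m*2<2*n = *-cancelʳ-< _ m n (subst (m * 2 <_) (*-comm 2 n) m*2<2*n)

B[2^k∸[1+d]]+B[d]≡k : ∀ k d → d < 2 ^ k → B (2 ^ k ∸ suc d) + B d ≡ k
B[2^k∸[1+d]]+B[d]≡k zero    zero    _         = refl
B[2^k∸[1+d]]+B[d]≡k zero    (suc d) (s≤s ())
B[2^k∸[1+d]]+B[d]≡k (suc k) d       d<2^[1+k] with d divMod 2
... | result q Fin.zero refl = begin
  B (2 ^ suc k ∸ suc (q * 2)) + B (q * 2) ≡⟨ cong₂ _+_ (cong B complement) (B[r+q*2]≡r+B[q] 0 q z<s) ⟩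
  B (1 + (2 ^ k ∸ suc q) * 2) + B q       ≡⟨ cong (_+ B q) (B[r+q*2]≡r+B[q] 1 (2 ^ k ∸ suc q) ≤-refl) ⟩
  suc (B (2 ^ k ∸ suc q) + B q)           ≡⟨ cong suc (B[2^k∸[1+d]]+B[d]≡k k q q<2^k) ⟩
  suc k                                   ∎
  where
  q<2^k : q < 2 ^ k
  q<2^k = m*2<2*n⇒m<n d<2^[1+k]
  complement : 2 ^ suc k ∸ suc (q * 2) ≡ 1 + (2 ^ k ∸ suc q) * 2
  complement = begin
    2 ^ suc k ∸ suc (q * 2)         ≡⟨ +-∸-assoc 1 (subst (suc q * 2 ≤_) (*-comm (2 ^ k) 2) (*-monoˡ-≤ 2 q<2^k)) ⟩
    1 + (2 ^ suc k ∸ suc q * 2)     ≡⟨ cong (1 +_) ([m∸n]*2≡2*m∸n*2 (2 ^ k) (suc q)) ⟨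
    1 + (2 ^ k ∸ suc q) * 2         ∎
... | result q (Fin.suc Fin.zero) refl = begin
  B (2 ^ suc k ∸ suc (1 + q * 2)) + B (1 + q * 2) ≡⟨ cong₂ _+_ (cong B complement) (B[r+q*2]≡r+B[q] 1 q ≤-refl) ⟩
  B ((2 ^ k ∸ suc q) * 2) + suc (B q)             ≡⟨ cong (_+ suc (B q)) (B[r+q*2]≡r+B[q] 0 (2 ^ k ∸ suc q) z<s) ⟩
  B (2 ^ k ∸ suc q) + suc (B q)                   ≡⟨ +-suc (B (2 ^ k ∸ suc q)) (B q) ⟩
  suc (B (2 ^ k ∸ suc q) + B q)                   ≡⟨ cong suc (B[2^k∸[1+d]]+B[d]≡k k q q<2^k) ⟩
  suc k                                           ∎
  where
  q<2^k : q < 2 ^ k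
  q<2^k = m*2<2*n⇒m<n (<-trans (n<1+n (q * 2)) d<2^[1+k])
  complement : 2 ^ suc k ∸ suc (1 + q * 2) ≡ (2 ^ k ∸ suc q) * 2
  complement = sym ([m∸n]*2≡2*m∸n*2 (2 ^ k) (suc q))

B[a*2^k∸b]+B[b∸1]≡B[a∸1]+k : ∀ k {a b} → 0 < a → 0 < b → b ≤ 2 ^ k →
                              B (a * 2 ^ k ∸ b) + B (b ∸ 1) ≡ B (a ∸ 1) + k
B[a*2^k∸b]+B[b∸1]≡B[a∸1]+k k {suc a} {suc b} _ _ b<2^k = begin
  B (suc a * 2 ^ k ∸ suc b) + B b                ≡⟨ cong (λ x → B x + B b) borrow ⟩
  B (a * 2 ^ k + (2 ^ k ∸ suc b)) + B b          ≡⟨ cong (_+ B b) (B[a*2^k+c]≡B[a]+B[c] k a _ (∸-monoʳ-< z<s b<2^k)) ⟩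
  B a + B (2 ^ k ∸ suc b) + B b                  ≡⟨ +-assoc (B a) _ (B b) ⟩
  B a + (B (2 ^ k ∸ suc b) + B b)                ≡⟨ cong (B a +_) (B[2^k∸[1+d]]+B[d]≡k k b b<2^k) ⟩
  B a + k                                        ∎
  where
  borrow : suc a * 2 ^ k ∸ suc b ≡ a * 2 ^ k + (2 ^ k ∸ suc b)
  borrow = trans (cong (_∸ suc b) (+-comm (2 ^ k) (a * 2 ^ k))) (+-∸-assoc (a * 2 ^ k) b<2^k)

2^h∸1<2^h : ∀ h → 2 ^ h ∸ 1 < 2 ^ h
2^h∸1<2^h h = ∸-monoʳ-< z<s (m^n>0 2 h)

1+B[n*[2^h∸1]∸1]≡h : ∀ {n h} → 0 < n → n % 2 ≡ 1 → n < 2 ^ h → suc (B (n * (2 ^ h ∸ 1) ∸ 1)) ≡ h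
1+B[n*[2^h∸1]∸1]≡h {n} {h} 0<n n%2≡1 n<2^h = +-cancelʳ-≡ (B (n ∸ 1)) _ h (begin
  suc (B x) + B (n ∸ 1)        ≡⟨ +-suc (B x) (B (n ∸ 1)) ⟨
  B x + suc (B (n ∸ 1))        ≡⟨ cong (B x +_) (odd⇒B[n]≡1+B[n∸1] {n} n%2≡1) ⟨
  B x + B n                    ≡⟨ cong (λ y → B y + B n) x≡n*2^h∸[1+n] ⟩
  B (n * 2 ^ h ∸ suc n) + B n  ≡⟨ B[a*2^k∸b]+B[b∸1]≡B[a∸1]+k h 0<n z<s n<2^h ⟩
  B (n ∸ 1) + h                ≡⟨ +-comm (B (n ∸ 1)) h ⟩
  h + B (n ∸ 1)                ∎)
  where
  x = n * (2 ^ h ∸ 1) ∸ 1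
  x≡n*2^h∸[1+n] : x ≡ n * 2 ^ h ∸ suc n
  x≡n*2^h∸[1+n] = begin
    n * (2 ^ h ∸ 1) ∸ 1      ≡⟨ cong (_∸ 1) (*-distribˡ-∸ n (2 ^ h) 1) ⟩
    n * 2 ^ h ∸ n * 1 ∸ 1    ≡⟨ ∸-+-assoc (n * 2 ^ h) (n * 1) 1 ⟩
    n * 2 ^ h ∸ (n * 1 + 1)  ≡⟨ cong (n * 2 ^ h ∸_) (trans (+-comm (n * 1) 1) (cong suc (*-identityʳ n))) ⟩
    n * 2 ^ h ∸ suc n        ∎

B[[2^h∸1]²]≡h : ∀ {h} → 0 < h → B ((2 ^ h ∸ 1) * (2 ^ h ∸ 1)) ≡ h
B[[2^h∸1]²]≡h {h} 0<h = +-cancelʳ-≡ (B (m ∸ 1)) _ h (begin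
  B (m * m) + B (m ∸ 1)          ≡⟨ cong (λ y → B y + B (m ∸ 1)) m*m≡m*2^h∸m ⟩
  B (m * 2 ^ h ∸ m) + B (m ∸ 1)  ≡⟨ B[a*2^k∸b]+B[b∸1]≡B[a∸1]+k h 0<m 0<m (<⇒≤ (2^h∸1<2^h h)) ⟩
  B (m ∸ 1) + h                  ≡⟨ +-comm (B (m ∸ 1)) h ⟩
  h + B (m ∸ 1)                  ∎)
  where
  m = 2 ^ h ∸ 1
  0<m : 0 < m
  0<m = m<n⇒0<n∸m (^-monoʳ-< 2 ≤-refl 0<h)
  m*m≡m*2^h∸m : m * m ≡ m * 2 ^ h ∸ m
  m*m≡m*2^h∸m = trans (*-distribˡ-∸ m (2 ^ h) 1) (cong (m * 2 ^ h ∸_) (*-identityʳ m))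

[X∸m]²≡[Y∸Z]*K+m² : ∀ {X m Y Z K} → m ≤ X → Z ≤ Y → Y * K ≡ X * X → Z * K ≡ 2 * X * m →
                     (X ∸ m) * (X ∸ m) ≡ (Y ∸ Z) * K + m * m
[X∸m]²≡[Y∸Z]*K+m² {X} {m} {Y} {Z} {K} m≤X Z≤Y =
  expand {X ∸ m} {m} {Y ∸ Z} {Z} {K = K} (m∸n+n≡m m≤X) (m∸n+n≡m Z≤Y)
  where
  expand : ∀ {x m y Z X Y K} → x + m ≡ X → y + Z ≡ Y → Y * K ≡ X * X → Z * K ≡ 2 * X * m →
           x * x ≡ y * K + m * m
  expand {x} {m} {y} {Z} {K = K} refl refl YK≡XX ZK≡2Xm = +-cancelʳ-≡ (Z * K) (x * x) (y * K + m * m) (begin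
    x * x + Z * K               ≡⟨ cong (x * x +_) ZK≡2Xm ⟩
    x * x + 2 * (x + m) * m     ≡⟨ solve (x ∷ m ∷ []) ⟩
    (x + m) * (x + m) + m * m   ≡⟨ cong (_+ m * m) YK≡XX ⟨
    (y + Z) * K + m * m         ≡⟨ solve (y ∷ Z ∷ K ∷ m ∷ []) ⟩
    y * K + m * m + Z * K       ∎)

[n*2P∸m]²≡[n*n*P∸n*m]*4P+m² : ∀ n m P → m ≤ n * (2 * P) → n * m ≤ n * n * P →
  (n * (2 * P) ∸ m) * (n * (2 * P) ∸ m) ≡ (n * n * P ∸ n * m) * (2 * (2 * P)) + m * m
[n*2P∸m]²≡[n*n*P∸n*m]*4P+m² n m P m≤n*2P n*m≤n*n*P =
  [X∸m]²≡[Y∸Z]*K+m² m≤n*2P n*m≤n*n*P (solve (n ∷ P ∷ [])) (solve (n ∷ m ∷ P ∷ []))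

B[n*2^ν∸[2^h∸1]]≡B[n]+ν∸h : ∀ {n h ν} → 0 < n → n % 2 ≡ 1 → 0 < h → h ≤ ν →
                             B (n * 2 ^ ν ∸ (2 ^ h ∸ 1)) ≡ B n + ν ∸ h
B[n*2^ν∸[2^h∸1]]≡B[n]+ν∸h {n} {h} {ν} 0<n n%2≡1 0<h h≤ν = begin
  B x                    ≡⟨ m+n∸n≡m (B x) q ⟨
  B x + q ∸ q            ≡⟨ cong (_∸ q) borrow ⟩
  p + ν ∸ q              ≡⟨ cong (suc (p + ν) ∸_) (+-comm 1 q) ⟩
  suc p + ν ∸ (q + 1)    ≡⟨ cong₂ (λ a b → a + ν ∸ b) (odd⇒B[n]≡1+B[n∸1] {n} n%2≡1) (sym q+1≡h) ⟨
  B n + ν ∸ h            ∎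
  where
  m = 2 ^ h ∸ 1
  x = n * 2 ^ ν ∸ m
  p = B (n ∸ 1)
  q = B (m ∸ 1)
  1<2^h : 1 < 2 ^ h
  1<2^h = ^-monoʳ-< 2 ≤-refl 0<h
  borrow : B x + q ≡ p + ν
  borrow = B[a*2^k∸b]+B[b∸1]≡B[a∸1]+k ν 0<n (m<n⇒0<n∸m 1<2^h)
             (≤-trans (<⇒≤ (2^h∸1<2^h h)) (^-monoʳ-≤ 2 h≤ν))
  q+1≡h : q + 1 ≡ h
  q+1≡h = trans (cong (λ y → B y + 1) (∸-+-assoc (2 ^ h) 1 1)) (B[2^k∸[1+d]]+B[d]≡k h 1 1<2^h)

B[[n*2^ν∸[2^h∸1]]²]≡B[n*n]+ν∸1 : ∀ {n h ν} → 0 < n → n % 2 ≡ 1 → 0 < h → n < 2 ^ h ∸ 1 → h + h < ν →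
  B ((n * 2 ^ ν ∸ (2 ^ h ∸ 1)) * (n * 2 ^ ν ∸ (2 ^ h ∸ 1))) ≡ B (n * n) + ν ∸ 1
B[[n*2^ν∸[2^h∸1]]²]≡B[n*n]+ν∸1 {n} {h} {suc μ} 0<n n%2≡1 0<h n<m (s≤s h+h≤μ) = begin
  B (x * x)                       ≡⟨ cong B x²≡y*2^[2+μ]+m² ⟩
  B (y * 2 ^ suc (suc μ) + m * m) ≡⟨ B[a*2^k+c]≡B[a]+B[c] (suc (suc μ)) y (m * m) m*m<2^[2+μ] ⟩
  B y + B (m * m)                 ≡⟨ cong (B y +_) (B[[2^h∸1]²]≡h 0<h) ⟩
  B y + h                         ≡⟨ cong (B y +_) (1+B[n*[2^h∸1]∸1]≡h 0<n n%2≡1 n<2^h) ⟨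
  B y + suc (B (n * m ∸ 1))       ≡⟨ +-suc (B y) _ ⟩
  suc (B y + B (n * m ∸ 1))       ≡⟨ cong suc borrow ⟩
  suc (B (n * n ∸ 1) + μ)         ≡⟨ cong (_+ μ) (odd⇒B[n]≡1+B[n∸1] {n * n} n*n%2≡1) ⟨
  B (n * n) + μ                   ≡⟨ cong (_∸ 1) (+-suc (B (n * n)) μ) ⟨
  B (n * n) + suc μ ∸ 1           ∎
  where
  m = 2 ^ h ∸ 1
  P = 2 ^ μ
  x = n * 2 ^ suc μ ∸ m
  y = n * n * P ∸ n * m
  instance
    n≢0 : NonZero n
    n≢0 = >-nonZero 0<n
  n<2^h : n < 2 ^ h
  n<2^h = <-trans n<m (2^h∸1<2^h h)
  m*m<2^[h+h] : m * m < 2 ^ (h + h)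
  m*m<2^[h+h] = subst (m * m <_) (sym (^-distribˡ-+-* 2 h h)) (*-mono-< (2^h∸1<2^h h) (2^h∸1<2^h h))
  m*m<2^[2+μ] : m * m < 2 ^ suc (suc μ)
  m*m<2^[2+μ] = <-≤-trans m*m<2^[h+h] (^-monoʳ-≤ 2 (≤-trans h+h≤μ (m≤n+m μ 2)))
  n*m≤2^μ : n * m ≤ P
  n*m≤2^μ = ≤-trans (*-monoˡ-≤ m (<⇒≤ n<m)) (≤-trans (<⇒≤ m*m<2^[h+h]) (^-monoʳ-≤ 2 h+h≤μ))
  n*n%2≡1 : n * n % 2 ≡ 1
  n*n%2≡1 = trans (%-distribˡ-* n n 2) (cong₂ (λ a b → a * b % 2) n%2≡1 n%2≡1)
  borrow : B y + B (n * m ∸ 1) ≡ B (n * n ∸ 1) + μ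
  borrow = B[a*2^k∸b]+B[b∸1]≡B[a∸1]+k μ (*-mono-< 0<n 0<n) (*-mono-< 0<n (m<n⇒0<n n<m)) n*m≤2^μ
  x²≡y*2^[2+μ]+m² : x * x ≡ y * 2 ^ suc (suc μ) + m * m
  x²≡y*2^[2+μ]+m² = [n*2P∸m]²≡[n*n*P∸n*m]*4P+m² n m P m≤n*2^[1+μ]
                      (≤-trans n*m≤2^μ (m≤n*m P (n * n) {{m*n≢0 n n}}))
    where
    m≤n*2^[1+μ] : m ≤ n * 2 ^ suc μ
    m≤n*2^[1+μ] = ≤-trans (m≤n*m m n) (≤-trans n*m≤2^μ (≤-trans (m≤n*m P 2) (m≤n*m (2 * P) n)))

corollary2 : (n h ν : ℕ) → 1 ≤ n → n % 2 ≡ 1 → 1 ≤ h → n < 2 ^ h ∸ 1 →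
    2 * h + 1 ≤ ν →
    (B (n * 2 ^ ν ∸ (2 ^ h ∸ 1)) ≡ B n + ν ∸ h)
    × (B ((n * 2 ^ ν ∸ (2 ^ h ∸ 1)) * (n * 2 ^ ν ∸ (2 ^ h ∸ 1))) ≡ B (n * n) + ν ∸ 1)
corollary2 n h ν 0<n n%2≡1 0<h n<m 2h+1≤ν =
    B[n*2^ν∸[2^h∸1]]≡B[n]+ν∸h 0<n n%2≡1 0<h (≤-trans (m≤m+n h h) (<⇒≤ h+h<ν))
  , B[[n*2^ν∸[2^h∸1]]²]≡B[n*n]+ν∸1 0<n n%2≡1 0<h n<m h+h<ν
  where
  h+h<ν : h + h < ν
  h+h<ν = subst (_≤ ν) (trans (+-comm (2 * h) 1) (cong (λ k → suc (h + k)) (+-identityʳ h))) 2h+1≤ν
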